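{- The complete symmetric digraph $K_{10}^\ast$ admits a resolvable decomposition into directed $5$-cycles.
   Context: $K_n^\ast$ denotes the complete symmetric digraph of order $n$: it has $n$ vertices and, for each pair of distinct vertices $u,v$, both arcs $(u,v)$ and $(v,u)$. A decomposition of a digraph $D$ is a collection of subdigraphs whose arc sets partition the arc set of $D$. A resolution class is a subcollection whose members' vertex sets partition the vertex set of $D$; a decomposition is resolvable if it can be partitioned into resolution classes. -}

module Defs where

open import Data.Nat using (ℕ; suc)
open import Data.Nat.DivMod using (_mod_)
open import Data.Fin using (Fin; toℕ)
open import Data.Product using (Σ; ∃; ∃-syntax; _×_; proj₁)
open import Relation.Binary.PropositionalEquality using (_≡_; _≢_)
open import Function.Definitions using (Injective)

next : {k : ℕ} → Fin (suc k) → Fin (suc k)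
next {k} i = suc (toℕ i) mod (suc k)

-- A directed cycle of length suc k in the vertex set Fin n:
-- an injective cyclic sequence of vertices c 0, c 1, …, c k.
-- Its arcs are (c i, c (i+1 mod (suc k))).
DiCycle : (n k : ℕ) → Set
DiCycle n k = Σ (Fin (suc k) → Fin n) (Injective _≡_ _≡_)

IsArc : {n k : ℕ} → DiCycle n k → Fin n → Fin n → Set
IsArc C u v = ∃[ i ] (proj₁ C i ≡ u × proj₁ C (next i) ≡ v)

IsVertex : {n k : ℕ} → DiCycle n k → Fin n → Set
IsVertex C v = ∃[ i ] (proj₁ C i ≡ v)

∃! : {m : ℕ} → (Fin m → Set) → Set
∃! {m} P = ∃[ j ] (P j × ((j' : Fin m) → P j' → j' ≡ j))

-- The family Cs (indexed by Fin m) is a decomposition of K_n^*: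
-- every arc (u , v), u ≠ v, of K_n^* lies in exactly one member.
-- (Arcs of a DiCycle are automatically arcs of K_n^*, by injectivity.)
IsDecompositionOfKStar : {n k m : ℕ} → (Fin m → DiCycle n k) → Set
IsDecompositionOfKStar {n} Cs =
  (u v : Fin n) → u ≢ v → ∃! (λ j → IsArc (Cs j) u v)

IsResolvable : {n k m : ℕ} → (Fin m → DiCycle n k) → Set
IsResolvable {n} {k} {m} Cs =
  ∃[ r ] Σ (Fin m → Fin r) λ cls →
    (c : Fin r) (v : Fin n) → ∃! (λ j → cls j ≡ c × IsVertex (Cs j) v)

module Submission where

open import Defs
open import Data.Nat using (ℕ; _*_)
open import Data.Fin using (Fin; #_; _≟_; quotient; remainder)
open import Data.Fin.Properties using (any?; all?)
open import Data.Vec using (Vec; _∷_; []; lookup)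
open import Data.Product using (Σ; ∃-syntax; _×_; _,_)
open import Data.Unit using (tt)
open import Function.Definitions using (Injective)
open import Relation.Nullary using (Dec; ¬?)
open import Relation.Nullary.Decidable using (map′; toWitness; _×-dec_; _→-dec_)
open import Relation.Binary.PropositionalEquality using (_≡_)

-- Every property involved quantifies over finite index sets only, so it is
-- decidable; the theorem is then an explicit design (nine resolution classes,
-- each a pair of vertex-disjoint directed 5-cycles covering the 90 arcs of
-- K₁₀* once) whose properties are checked by evaluating the decision procedures.

injective? : {m n : ℕ} (f : Fin m → Fin n) → Dec (Injective _≡_ _≡_ f)
injective? f =
  map′ (λ inj {x} {y} → inj x y) (λ inj x y → inj {x} {y})
       (all? λ x → all? λ y → (f x ≟ f y) →-dec (x ≟ y))

∃!? : {m : ℕ} {P : Fin m → Set} → ((j : Fin m) → Dec (P j)) → Dec (∃! P)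
∃!? P? = any? λ j → P? j ×-dec all? λ j′ → P? j′ →-dec (j′ ≟ j)

isArc? : {n k : ℕ} (C : DiCycle n k) (u v : Fin n) → Dec (IsArc C u v)
isArc? (c , _) u v = any? λ i → (c i ≟ u) ×-dec (c (next i) ≟ v)

isVertex? : {n k : ℕ} (C : DiCycle n k) (v : Fin n) → Dec (IsVertex C v)
isVertex? (c , _) v = any? λ i → c i ≟ v

isDecompositionOfKStar? : {n k m : ℕ} (Cs : Fin m → DiCycle n k) →
                          Dec (IsDecompositionOfKStar Cs)
isDecompositionOfKStar? Cs =
  all? λ u → all? λ v → ¬? (u ≟ v) →-dec ∃!? λ j → isArc? (Cs j) u v

IsResolution : {n k m r : ℕ} → (Fin m → DiCycle n k) → (Fin m → Fin r) → Set
IsResolution {n} {r = r} Cs cls =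
  (c : Fin r) (v : Fin n) → ∃! λ j → cls j ≡ c × IsVertex (Cs j) v

isResolution? : {n k m r : ℕ} (Cs : Fin m → DiCycle n k) (cls : Fin m → Fin r) →
                Dec (IsResolution Cs cls)
isResolution? Cs cls =
  all? λ c → all? λ v → ∃!? λ j → (cls j ≟ c) ×-dec isVertex? (Cs j) v

resolutionClasses : Vec (Vec (Vec (Fin 10) 5) 2) 9
resolutionClasses =
    ((# 0 ∷ # 1 ∷ # 5 ∷ # 4 ∷ # 3 ∷ []) ∷ (# 2 ∷ # 8 ∷ # 7 ∷ # 9 ∷ # 6 ∷ []) ∷ [])
  ∷ ((# 0 ∷ # 2 ∷ # 3 ∷ # 4 ∷ # 5 ∷ []) ∷ (# 1 ∷ # 9 ∷ # 7 ∷ # 8 ∷ # 6 ∷ []) ∷ [])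
  ∷ ((# 0 ∷ # 3 ∷ # 2 ∷ # 4 ∷ # 9 ∷ []) ∷ (# 1 ∷ # 7 ∷ # 6 ∷ # 8 ∷ # 5 ∷ []) ∷ [])
  ∷ ((# 0 ∷ # 4 ∷ # 1 ∷ # 3 ∷ # 7 ∷ []) ∷ (# 2 ∷ # 6 ∷ # 9 ∷ # 5 ∷ # 8 ∷ []) ∷ [])
  ∷ ((# 0 ∷ # 5 ∷ # 2 ∷ # 1 ∷ # 8 ∷ []) ∷ (# 3 ∷ # 9 ∷ # 4 ∷ # 6 ∷ # 7 ∷ []) ∷ [])
  ∷ ((# 0 ∷ # 6 ∷ # 5 ∷ # 3 ∷ # 1 ∷ []) ∷ (# 2 ∷ # 7 ∷ # 4 ∷ # 8 ∷ # 9 ∷ []) ∷ [])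
  ∷ ((# 0 ∷ # 7 ∷ # 5 ∷ # 6 ∷ # 4 ∷ []) ∷ (# 1 ∷ # 2 ∷ # 9 ∷ # 3 ∷ # 8 ∷ []) ∷ [])
  ∷ ((# 0 ∷ # 8 ∷ # 4 ∷ # 7 ∷ # 2 ∷ []) ∷ (# 1 ∷ # 6 ∷ # 3 ∷ # 5 ∷ # 9 ∷ []) ∷ [])
  ∷ ((# 0 ∷ # 9 ∷ # 8 ∷ # 3 ∷ # 6 ∷ []) ∷ (# 1 ∷ # 4 ∷ # 2 ∷ # 5 ∷ # 7 ∷ []) ∷ [])
  ∷ []

classOf : Fin (9 * 2) → Fin 9
classOf = quotient {9} 2

cycleVertices : Fin (9 * 2) → Fin 5 → Fin 10
cycleVertices j = lookup (lookup (lookup resolutionClasses (classOf j)) (remainder {9} 2 j))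

cycleVertices-injective : (j : Fin (9 * 2)) → Injective _≡_ _≡_ (cycleVertices j)
cycleVertices-injective = toWitness {a? = all? λ j → injective? (cycleVertices j)} tt

cycles : Fin (9 * 2) → DiCycle 10 4
cycles j = cycleVertices j , cycleVertices-injective j

cycles-decomposeKStar : IsDecompositionOfKStar cycles
cycles-decomposeKStar = toWitness {a? = isDecompositionOfKStar? cycles} tt

cycles-resolvedByClassOf : IsResolution cycles classOf
cycles-resolvedByClassOf = toWitness {a? = isResolution? cycles classOf} tt

lemma3p1 : ∃[ m ] Σ (Fin m → DiCycle 10 4) λ Cs → IsDecompositionOfKStar Cs × IsResolvable Cs
lemma3p1 = 9 * 2 , cycles , cycles-decomposeKStar , (9 , classOf , cycles-resolvedByClassOf)
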